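{- Let $n\geq 4$ and let $C=\operatorname{circ}(1,0,\ldots,0,-1)$ be the circulant matrix of order $n-1$. Let \[N=\left[\begin{array}{c|c} \mathbf{1}^T & \mathbf{0}^T \\ \hline -I_{n-1} & C \end{array}\right]\] (an oriented incidence matrix of the wheel graph $W_n$). Then $CC^T+I_{n-1}$ is invertible and the Moore–Penrose inverse of $N$ is \[N^+=\frac{1}{n} \left[\begin{array}{r|c} \mathbf{1} & X \\ \hline \mathbf{0} & Y \end{array}\right],\] where $X=(CC^T+I_{n-1})^{ -1}(J_{n-1}-nI_{n-1})$ and $Y=-C^TX$.
   Context: For real numbers $c_0,\ldots,c_{k-1}$, $\operatorname{circ}(c_0,c_1,\ldots,c_{k-1})$ denotes the $k\times k$ circulant matrix whose $(i,j)$-entry is $c_{(j-i)\bmod k}$. $\mathbf{1}$, $\mathbf{0}$ are the all-ones and all-zeros column vectors of length $n-1$, $I_k$ the $k\times k$ identity and $J_k$ the $k\times k$ all-ones matrix. The wheel graph $W_n$ is obtained from a cycle on $n-1$ vertices by adding a vertex adjacent to all of them; an oriented incidence matrix is obtained from the vertex-edge incidence matrix by changing one of the two 1s in each column to $-1$. The Moore–Penrose inverse of a real matrix $A$ is the unique matrix $A^+$ with $AA^+A=A$, $A^+AA^+=A^+$, $(AA^+)^T=AA^+$, $(A^+A)^T=A^+A$. -}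

module Defs where

open import Data.Nat as ℕ using (ℕ; zero; suc; _∸_)
open import Data.Nat.DivMod using (_mod_)
open import Data.Fin using (Fin; zero; suc; toℕ; splitAt)
open import Data.Sum using (_⊎_; inj₁; inj₂)
open import Data.Bool using (if_then_else_)
open import Data.Rational using (ℚ; 0ℚ; 1ℚ; _+_; _*_; -_)
open import Relation.Nullary.Decidable using (⌊_⌋)
open import Relation.Binary.PropositionalEquality using (_≡_)
open import Data.Product using (_×_)

-- Real matrices are represented over ℚ (all data are rational).
Matrix : ℕ → ℕ → Set
Matrix r c = Fin r → Fin c → ℚ

Σ : (k : ℕ) → (Fin k → ℚ) → ℚ
Σ zero    f = 0ℚ
Σ (suc k) f = f zero + Σ k (λ i → f (suc i))

infixl 7 _·_
infixl 6 _⊕_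
infix 8 _ᵀ
_·_ : ∀ {r s t} → Matrix r s → Matrix s t → Matrix r t
_·_ {s = s} A B i j = Σ s (λ k → A i k * B k j)

_ᵀ : ∀ {r c} → Matrix r c → Matrix c r
(A ᵀ) i j = A j i

_⊕_ : ∀ {r c} → Matrix r c → Matrix r c → Matrix r c
(A ⊕ B) i j = A i j + B i j

neg : ∀ {r c} → Matrix r c → Matrix r c
neg A i j = - A i j

scale : ∀ {r c} → ℚ → Matrix r c → Matrix r c
scale a A i j = a * A i j

I : (k : ℕ) → Matrix k k
I k i j = if ⌊ toℕ i ℕ.≟ toℕ j ⌋ then 1ℚ else 0ℚ

J : (k : ℕ) → Matrix k k
J k i j = 1ℚ

-- circ(c_0,…,c_{k-1}) : (i,j)-entry is c_{(j-i) mod k}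
circ : (k : ℕ) → (Fin k → ℚ) → Matrix k k
circ zero    c ()
circ (suc k) c i j = c ((toℕ j ℕ.+ (suc k ∸ toℕ i)) mod (suc k))

oneZerosMinusOne : (k : ℕ) → Fin k → ℚ
oneZerosMinusOne k i =
  if ⌊ toℕ i ℕ.≟ 0 ⌋ then 1ℚ
  else if ⌊ suc (toℕ i) ℕ.≟ k ⌋ then - 1ℚ
  else 0ℚ

-- Moore–Penrose inverse: P is THE Moore–Penrose inverse of A
-- (the four Penrose conditions, which determine it uniquely)
IsMoorePenroseInverse : ∀ {r c} → Matrix r c → Matrix c r → Set
IsMoorePenroseInverse A P =
  (∀ i j → (A · P · A) i j ≡ A i j) ×
  ((∀ i j → (P · A · P) i j ≡ P i j) ×
  ((∀ i j → ((A · P) ᵀ) i j ≡ (A · P) i j) ×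
   (∀ i j → ((P · A) ᵀ) i j ≡ (P · A) i j)))

IsInverse : ∀ {k} → Matrix k k → Matrix k k → Set
IsInverse A B = (∀ i j → (A · B) i j ≡ I _ i j) × (∀ i j → (B · A) i j ≡ I _ i j)

blockN : ∀ {m} → (Fin m → ℚ) → (Fin m → ℚ) → Matrix m m → Matrix m m → Matrix (suc m) (m ℕ.+ m)
blockN {m} a b C D zero    j with splitAt m j
... | inj₁ k = a k
... | inj₂ k = b k
blockN {m} a b C D (suc i) j with splitAt m j
... | inj₁ k = C i k
... | inj₂ k = D i k

blockP : ∀ {m} → (Fin m → ℚ) → Matrix m m → (Fin m → ℚ) → Matrix m m → Matrix (m ℕ.+ m) (suc m)
blockP {m} u X v Y i j with splitAt m i | j
... | inj₁ k | zero  = u k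
... | inj₁ k | suc l = X k l
... | inj₂ k | zero  = v k
... | inj₂ k | suc l = Y k l

-- The columns of C sum to zero, so J N = 0 and C Cᵀ + I has all row sums 1; hence its
-- inverse M is symmetric with row sums 1, and X = M (J − n I) = J − n M is symmetric.
-- Multiplying out the blocks gives N P = I − J/n, and P N = (1/n) [J − X, X C; Cᵀ X, −Cᵀ X C]
-- is symmetric. The two remaining Penrose identities then follow from J N = 0 and P J = 0.
-- For the cycle, C Cᵀ + I = 3 I − S − S⁻¹ with S the cyclic shift, and its inverse is the
-- circulant matrix with entries g |a − b|, g d = (F (2d) + F (2(m − d))) / D for the Fibonacci
-- numbers F: both terms solve u (d + 2) − 3 u (d + 1) + u d = 0, which makes row a of
-- (3 I − S − S⁻¹) M vanish off the diagonal, and D is chosen to make the diagonal entry 1.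

module Submission where

open import Defs
open import Data.Nat using (ℕ; suc; _≤_)
open import Data.Integer using (+_)
open import Data.Rational using (ℚ; 0ℚ; 1ℚ; _/_)
open import Data.Product using (_×_; Σ-syntax; _,_; proj₁; proj₂)

open import Algebra.Bundles using (CommutativeRing)
open import Data.Bool using (true; false; if_then_else_)
open import Data.Empty using (⊥-elim)
open import Data.Fin using (Fin; zero; suc; toℕ; fromℕ<; _↑ˡ_; _↑ʳ_; splitAt)
import Data.Fin.Properties as FP
import Data.Integer as ℤ
open import Data.Integer.Tactic.RingSolver using (solve-∀)
import Data.Nat as ℕ
open import Data.Nat using (zero; _<_; _∸_; ∣_-_∣)
open import Data.Nat.DivMod using (_%_; m%n<n; [m+n]%n≡m%n; m<n⇒m%n≡m)
import Data.Nat.Properties as ℕP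
open import Data.Rational using (_+_; _*_; -_; _-_; 1/_; toℚᵘ; Positive; NonNegative; positive; nonNegative)
import Data.Rational.Properties as ℚP
open import Data.Rational.Solver using (module +-*-Solver)
import Data.Rational.Unnormalised as ℚᵘ
import Data.Rational.Unnormalised.Properties as UP
open import Data.Sum using ([_,_]; inj₁; inj₂)
open import Function using (_∘_)
open import Relation.Binary.Definitions using (tri<; tri≈; tri>)
open import Relation.Binary.PropositionalEquality hiding (J; [_])
open import Relation.Nullary using (Dec; yes; no)
open import Relation.Nullary.Decidable using (⌊_⌋; isYes≗does; dec-true; dec-false)

open import Algebra.Properties.Semiring.Sum (CommutativeRing.semiring ℚP.+-*-commutativeRing)
  using (sum; sum-cong-≗; ∑-distrib-+; ∑-comm; *-distribˡ-sum; sum-replicate-zero)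
open +-*-Solver

-- I k i j unfolds to δ (toℕ i) (toℕ j).
δ : ℕ → ℕ → ℚ
δ x y = if ⌊ x ℕ.≟ y ⌋ then 1ℚ else 0ℚ

δ-≡ : ∀ {x y} → x ≡ y → δ x y ≡ 1ℚ
δ-≡ {x} {y} x≡y = cong (if_then 1ℚ else 0ℚ) (trans (isYes≗does (x ℕ.≟ y)) (dec-true (x ℕ.≟ y) x≡y))

δ-≢ : ∀ {x y} → x ≢ y → δ x y ≡ 0ℚ
δ-≢ {x} {y} x≢y = cong (if_then 1ℚ else 0ℚ) (trans (isYes≗does (x ℕ.≟ y)) (dec-false (x ℕ.≟ y) x≢y))

δ-cong-⇔ : ∀ {x y x′ y′} → (x ≡ y → x′ ≡ y′) → (x′ ≡ y′ → x ≡ y) → δ x y ≡ δ x′ y′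
δ-cong-⇔ {x} {y} {x′} {y′} to from = by-cases (x ℕ.≟ y)
  where
  by-cases : Dec (x ≡ y) → δ x y ≡ δ x′ y′
  by-cases (yes x≡y) = trans (δ-≡ x≡y) (sym (δ-≡ (to x≡y)))
  by-cases (no x≢y)  = trans (δ-≢ x≢y) (sym (δ-≢ (x≢y ∘ from)))

δ-sym : ∀ x y → δ x y ≡ δ y x
δ-sym x y = δ-cong-⇔ {x} {y} sym sym

δ-suc : ∀ x y → δ (suc x) (suc y) ≡ δ x y
δ-suc x y = δ-cong-⇔ {suc x} {suc y} ℕP.suc-injective (cong suc)

Σ≡sum : ∀ k (f : Fin k → ℚ) → Σ k f ≡ sum f
Σ≡sum zero    f = refl
Σ≡sum (suc k) f = cong (λ s → f zero + s) (Σ≡sum k (f ∘ suc))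

Σ-cong : ∀ k {f g : Fin k → ℚ} → (∀ i → f i ≡ g i) → Σ k f ≡ Σ k g
Σ-cong k {f} {g} f≗g = trans (Σ≡sum k f) (trans (sum-cong-≗ f≗g) (sym (Σ≡sum k g)))

Σ-zero : ∀ k → Σ k (λ _ → 0ℚ) ≡ 0ℚ
Σ-zero k = trans (Σ≡sum k _) (sum-replicate-zero k)

Σ-distrib-+ : ∀ k (f g : Fin k → ℚ) → Σ k (λ i → f i + g i) ≡ Σ k f + Σ k g
Σ-distrib-+ k f g = trans (Σ≡sum k _)
  (trans (∑-distrib-+ f g) (sym (cong₂ _+_ (Σ≡sum k f) (Σ≡sum k g))))

Σ-*ˡ : ∀ k a (f : Fin k → ℚ) → Σ k (λ i → a * f i) ≡ a * Σ k f
Σ-*ˡ k a f = trans (Σ≡sum k _) (sym (trans (cong (a *_) (Σ≡sum k f)) (*-distribˡ-sum a f)))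

Σ-comm : ∀ r s (f : Fin r → Fin s → ℚ) →
         Σ r (λ i → Σ s (f i)) ≡ Σ s (λ j → Σ r (λ i → f i j))
Σ-comm r s f = trans (Σ-as-sum² r s f) (trans (∑-comm f) (sym (Σ-as-sum² s r (λ j i → f i j))))
  where
  Σ-as-sum² : ∀ r s (f : Fin r → Fin s → ℚ) → Σ r (λ i → Σ s (f i)) ≡ sum (λ i → sum (f i))
  Σ-as-sum² r s f = trans (Σ≡sum r _) (sum-cong-≗ (λ i → Σ≡sum s (f i)))

Σ-neg : ∀ k (f : Fin k → ℚ) → Σ k (λ i → - f i) ≡ - Σ k f
Σ-neg zero    f = refl
Σ-neg (suc k) f = trans (cong (λ s → - f zero + s) (Σ-neg k (f ∘ suc)))
                        (sym (ℚP.neg-distrib-+ (f zero) (Σ k (f ∘ suc))))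

Σ-distrib-- : ∀ k (f g : Fin k → ℚ) → Σ k (λ i → f i - g i) ≡ Σ k f - Σ k g
Σ-distrib-- k f g = trans (Σ-distrib-+ k f (λ i → - g i)) (cong (λ s → Σ k f + s) (Σ-neg k g))

Σ-*ʳ : ∀ k a (f : Fin k → ℚ) → Σ k (λ i → f i * a) ≡ Σ k f * a
Σ-*ʳ k a f = trans (Σ-cong k (λ i → ℚP.*-comm (f i) a)) (trans (Σ-*ˡ k a f) (ℚP.*-comm a (Σ k f)))

Σ-++ : ∀ a b (f : Fin (a ℕ.+ b) → ℚ) → Σ (a ℕ.+ b) f ≡ Σ a (λ i → f (i ↑ˡ b)) + Σ b (λ j → f (a ↑ʳ j))
Σ-++ zero    b f = sym (ℚP.+-identityˡ _)
Σ-++ (suc a) b f = trans (cong (λ s → f zero + s) (Σ-++ a b (f ∘ suc))) (sym (ℚP.+-assoc (f zero) _ _))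

Σ-δ : ∀ k (f : Fin k → ℚ) (i : Fin k) → Σ k (λ l → δ (toℕ l) (toℕ i) * f l) ≡ f i
Σ-δ (suc k) f zero = begin
  1ℚ * f zero + Σ k (λ l → 0ℚ * f (suc l)) ≡⟨ cong₂ _+_ (ℚP.*-identityˡ (f zero)) (Σ-cong k (λ l → ℚP.*-zeroˡ (f (suc l)))) ⟩
  f zero + Σ k (λ _ → 0ℚ)                  ≡⟨ cong (λ s → f zero + s) (Σ-zero k) ⟩
  f zero + 0ℚ                              ≡⟨ ℚP.+-identityʳ (f zero) ⟩
  f zero                                   ∎
  where open ≡-Reasoning
Σ-δ (suc k) f (suc i) = trans (cong₂ _+_ (ℚP.*-zeroˡ (f zero)) shifted) (ℚP.+-identityˡ (f (suc i)))
  where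
  shifted : Σ k (λ l → δ (suc (toℕ l)) (suc (toℕ i)) * f (suc l)) ≡ f (suc i)
  shifted = trans (Σ-cong k (λ l → cong (_* f (suc l)) (δ-suc (toℕ l) (toℕ i)))) (Σ-δ k (f ∘ suc) i)

Σ-δℕ : ∀ k (F : ℕ → ℚ) {x} → x < k → Σ k (λ l → δ (toℕ l) x * F (toℕ l)) ≡ F x
Σ-δℕ k F x<k = subst (λ x → Σ k (λ l → δ (toℕ l) x * F (toℕ l)) ≡ F x) (FP.toℕ-fromℕ< x<k)
                     (Σ-δ k (F ∘ toℕ) (fromℕ< x<k))

+suc/1 : ∀ k → + suc k / 1 ≡ 1ℚ + + k / 1
+suc/1 k = ℚP.toℚᵘ-injective (begin
  toℚᵘ (+ suc k / 1)             ≈⟨ ℚP.toℚᵘ-fromℚᵘ (ℚᵘ.mkℚᵘ (+ suc k) 0) ⟩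
  ℚᵘ.mkℚᵘ (+ suc k) 0            ≈⟨ ℚᵘ.*≡* (cross (+ k)) ⟩
  toℚᵘ 1ℚ ℚᵘ.+ ℚᵘ.mkℚᵘ (+ k) 0   ≈⟨ UP.+-congʳ (toℚᵘ 1ℚ) (UP.≃-sym (ℚP.toℚᵘ-fromℚᵘ (ℚᵘ.mkℚᵘ (+ k) 0))) ⟩
  toℚᵘ 1ℚ ℚᵘ.+ toℚᵘ (+ k / 1)    ≈⟨ UP.≃-sym (ℚP.toℚᵘ-homo-+ 1ℚ (+ k / 1)) ⟩
  toℚᵘ (1ℚ + + k / 1)            ∎)
  where
  open UP.≃-Reasoning
  cross : ∀ (x : ℤ.ℤ) → (+ 1 ℤ.+ x) ℤ.* (+ 1 ℤ.* + 1) ≡ (+ 1 ℤ.* + 1 ℤ.+ x ℤ.* + 1) ℤ.* + 1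
  cross = solve-∀

1/n*n≡1 : ∀ k → (+ 1 / suc k) * (+ suc k / 1) ≡ 1ℚ
1/n*n≡1 k = ℚP.toℚᵘ-injective (begin
  toℚᵘ ((+ 1 / suc k) * (+ suc k / 1))                     ≈⟨ ℚP.toℚᵘ-homo-* (+ 1 / suc k) (+ suc k / 1) ⟩
  toℚᵘ (+ 1 / suc k) ℚᵘ.* toℚᵘ (+ suc k / 1)               ≈⟨ UP.*-cong (ℚP.toℚᵘ-fromℚᵘ (ℚᵘ.mkℚᵘ (+ 1) k))
                                                                        (ℚP.toℚᵘ-fromℚᵘ (ℚᵘ.mkℚᵘ (+ suc k) 0)) ⟩
  ℚᵘ.mkℚᵘ (+ 1) k ℚᵘ.* ℚᵘ.mkℚᵘ (+ suc k) 0                 ≈⟨ ℚᵘ.*≡* (cross (+ k)) ⟩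
  toℚᵘ 1ℚ                                                   ∎)
  where
  open UP.≃-Reasoning
  cross : ∀ (x : ℤ.ℤ) → (+ 1 ℤ.* (+ 1 ℤ.+ x)) ℤ.* + 1 ≡ + 1 ℤ.* ((+ 1 ℤ.+ x) ℤ.* + 1)
  cross = solve-∀

Σ-one : ∀ k → Σ k (λ _ → 1ℚ) ≡ + k / 1
Σ-one zero    = refl
Σ-one (suc k) = trans (cong (λ s → 1ℚ + s) (Σ-one k)) (sym (+suc/1 k))

infix 4 _≈_
_≈_ : ∀ {r c} → Matrix r c → Matrix r c → Set
A ≈ B = ∀ i j → A i j ≡ B i j

Symmetric : ∀ {k} → Matrix k k → Set
Symmetric A = A ᵀ ≈ A

rowSum : ∀ {r c} → Matrix r c → Fin r → ℚ
rowSum {c = c} A i = Σ c (A i)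

colSum : ∀ {r c} → Matrix r c → Fin c → ℚ
colSum {r} A j = Σ r (λ i → A i j)

module _ {r s : ℕ} where

  ·-congˡ : ∀ {t} {A A′ : Matrix r s} (B : Matrix s t) → A ≈ A′ → A · B ≈ A′ · B
  ·-congˡ B A≈A′ i j = Σ-cong s (λ k → cong (_* B k j) (A≈A′ i k))

  ·-congʳ : ∀ {t} (A : Matrix r s) {B B′ : Matrix s t} → B ≈ B′ → A · B ≈ A · B′
  ·-congʳ A B≈B′ i j = Σ-cong s (λ k → cong (A i k *_) (B≈B′ k j))

  ·-assoc : ∀ {t u} (A : Matrix r s) (B : Matrix s t) (C : Matrix t u) → (A · B) · C ≈ A · (B · C)
  ·-assoc {t} A B C i j = begin
    Σ t (λ l → Σ s (λ k → A i k * B k l) * C l j)   ≡⟨ Σ-cong t (λ l → sym (Σ-*ʳ s (C l j) (λ k → A i k * B k l))) ⟩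
    Σ t (λ l → Σ s (λ k → A i k * B k l * C l j))   ≡⟨ Σ-comm t s (λ l k → A i k * B k l * C l j) ⟩
    Σ s (λ k → Σ t (λ l → A i k * B k l * C l j))   ≡⟨ Σ-cong s (λ k → Σ-cong t (λ l → ℚP.*-assoc (A i k) (B k l) (C l j))) ⟩
    Σ s (λ k → Σ t (λ l → A i k * (B k l * C l j))) ≡⟨ Σ-cong s (λ k → Σ-*ˡ t (A i k) (λ l → B k l * C l j)) ⟩
    Σ s (λ k → A i k * Σ t (λ l → B k l * C l j))   ∎
    where open ≡-Reasoning

  ·-distribˡ : ∀ {t} (A : Matrix r s) (B C : Matrix s t) → A · (B ⊕ C) ≈ A · B ⊕ A · C
  ·-distribˡ A B C i j = trans (Σ-cong s (λ k → ℚP.*-distribˡ-+ (A i k) (B k j) (C k j))) (Σ-distrib-+ s _ _)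

  ·-distribʳ : ∀ {t} (A B : Matrix r s) (C : Matrix s t) → (A ⊕ B) · C ≈ A · C ⊕ B · C
  ·-distribʳ A B C i j = trans (Σ-cong s (λ k → ℚP.*-distribʳ-+ (C k j) (A i k) (B i k))) (Σ-distrib-+ s _ _)

  ·-negˡ : ∀ {t} (A : Matrix r s) (B : Matrix s t) → neg A · B ≈ neg (A · B)
  ·-negˡ A B i j = trans (Σ-cong s (λ k → sym (ℚP.neg-distribˡ-* (A i k) (B k j)))) (Σ-neg s _)

  ·-negʳ : ∀ {t} (A : Matrix r s) (B : Matrix s t) → A · neg B ≈ neg (A · B)
  ·-negʳ A B i j = trans (Σ-cong s (λ k → sym (ℚP.neg-distribʳ-* (A i k) (B k j)))) (Σ-neg s _)

  ·-scaleˡ : ∀ {t} a (A : Matrix r s) (B : Matrix s t) → scale a A · B ≈ scale a (A · B)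
  ·-scaleˡ a A B i j = trans (Σ-cong s (λ k → ℚP.*-assoc a (A i k) (B k j))) (Σ-*ˡ s a _)

  ·-scaleʳ : ∀ {t} a (A : Matrix r s) (B : Matrix s t) → A · scale a B ≈ scale a (A · B)
  ·-scaleʳ a A B i j = trans (Σ-cong s (λ k → *-comm-middle (A i k) a (B k j))) (Σ-*ˡ s a _)
    where
    *-comm-middle : ∀ x y z → x * (y * z) ≡ y * (x * z)
    *-comm-middle = solve 3 (λ x y z → x :* (y :* z) := y :* (x :* z)) refl

  ᵀ-· : ∀ {t} (A : Matrix r s) (B : Matrix s t) → (A · B) ᵀ ≈ B ᵀ · A ᵀ
  ᵀ-· A B i j = Σ-cong s (λ k → ℚP.*-comm (A j k) (B k i))

  ·-identityʳ : (A : Matrix r s) → A · I s ≈ A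
  ·-identityʳ A i j = trans (Σ-cong s (λ k → ℚP.*-comm (A i k) (I s k j))) (Σ-δ s (A i) j)

  ·-identityˡ : (A : Matrix r s) → I r · A ≈ A
  ·-identityˡ A i j = trans (Σ-cong r (λ k → cong (_* A k j) (δ-sym (toℕ i) (toℕ k)))) (Σ-δ r (λ k → A k j) i)

  ·-J : (A : Matrix r s) → ∀ i j → (A · J s) i j ≡ rowSum A i
  ·-J A i j = Σ-cong s (λ k → ℚP.*-identityʳ (A i k))

  rowSum-· : ∀ {t} (A : Matrix r s) (B : Matrix s t) {β} → (∀ k → rowSum B k ≡ β) →
             ∀ i → rowSum (A · B) i ≡ rowSum A i * β
  rowSum-· {t} A B {β} rowSum-B i = begin
    Σ t (λ j → Σ s (λ k → A i k * B k j)) ≡⟨ Σ-comm t s (λ j k → A i k * B k j) ⟩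
    Σ s (λ k → Σ t (λ j → A i k * B k j)) ≡⟨ Σ-cong s (λ k → trans (Σ-*ˡ t (A i k) (B k)) (cong (A i k *_) (rowSum-B k))) ⟩
    Σ s (λ k → A i k * β)                 ≡⟨ Σ-*ʳ s β (A i) ⟩
    rowSum A i * β                        ∎
    where open ≡-Reasoning

  colSum-· : ∀ {t} (A : Matrix r s) (B : Matrix s t) {β} → (∀ k → colSum A k ≡ β) →
             ∀ j → colSum (A · B) j ≡ β * colSum B j
  colSum-· A B {β} colSum-A j = begin
    Σ r (λ i → Σ s (λ k → A i k * B k j)) ≡⟨ Σ-comm r s (λ i k → A i k * B k j) ⟩
    Σ s (λ k → Σ r (λ i → A i k * B k j)) ≡⟨ Σ-cong s (λ k → trans (Σ-*ʳ r (B k j) (λ i → A i k)) (cong (_* B k j) (colSum-A k))) ⟩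
    Σ s (λ k → β * B k j)                 ≡⟨ Σ-*ˡ s β (λ k → B k j) ⟩
    β * colSum B j                        ∎
    where open ≡-Reasoning

rowSum-I : ∀ k i → rowSum (I k) i ≡ 1ℚ
rowSum-I k i = trans (Σ-cong k (λ j → trans (δ-sym (toℕ i) (toℕ j)) (sym (ℚP.*-identityʳ _)))) (Σ-δ k (λ _ → 1ℚ) i)

I-symmetric : ∀ k → Symmetric (I k)
I-symmetric k i j = δ-sym (toℕ j) (toℕ i)

·ᵀ⊕I-symmetric : ∀ {m} (C : Matrix m m) → Symmetric (C · C ᵀ ⊕ I m)
·ᵀ⊕I-symmetric {m} C i j = cong₂ _+_ (ᵀ-· C (C ᵀ) i j) (I-symmetric m i j)

symmetric-resp-≈ : ∀ {k} {A B : Matrix k k} → A ≈ B → Symmetric B → Symmetric A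
symmetric-resp-≈ A≈B B-sym i j = trans (A≈B j i) (trans (B-sym i j) (sym (A≈B i j)))

scale-symmetric : ∀ {k} c {A : Matrix k k} → Symmetric A → Symmetric (scale c A)
scale-symmetric c A-sym i j = cong (c *_) (A-sym i j)

module _ {k : ℕ} {A M : Matrix k k} (A-symmetric : Symmetric A) (AM≈I : A · M ≈ I k) where

  private
    ᵀ-AM≈I : (A · M) ᵀ ≈ I k
    ᵀ-AM≈I i j = trans (AM≈I j i) (I-symmetric k i j)

    Mᵀ·A≈[AM]ᵀ : M ᵀ · A ≈ (A · M) ᵀ
    Mᵀ·A≈[AM]ᵀ i j = trans (·-congʳ (M ᵀ) (λ a b → sym (A-symmetric a b)) i j) (sym (ᵀ-· A M i j))

  rightInverse-symmetric : Symmetric M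
  rightInverse-symmetric i j = begin
    M j i                  ≡⟨ sym (·-identityʳ (M ᵀ) i j) ⟩
    (M ᵀ · I k) i j        ≡⟨ ·-congʳ (M ᵀ) (λ a b → sym (AM≈I a b)) i j ⟩
    (M ᵀ · (A · M)) i j    ≡⟨ sym (·-assoc (M ᵀ) A M i j) ⟩
    ((M ᵀ · A) · M) i j    ≡⟨ ·-congˡ M (λ a b → trans (Mᵀ·A≈[AM]ᵀ a b) (ᵀ-AM≈I a b)) i j ⟩
    (I k · M) i j          ≡⟨ ·-identityˡ M i j ⟩
    M i j                  ∎
    where open ≡-Reasoning

  inverse-of-symmetric : IsInverse A M
  inverse-of-symmetric = AM≈I , MA≈I
    where
    MA≈I : M · A ≈ I k
    MA≈I i j = trans (·-congˡ A (λ a b → sym (rightInverse-symmetric a b)) i j)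
                     (trans (Mᵀ·A≈[AM]ᵀ i j) (ᵀ-AM≈I i j))

centering : ∀ r → ℚ → Matrix r r
centering r c = I r ⊕ neg (scale c (J r))

module _ {r : ℕ} (c : ℚ) where

  centering-symmetric : Symmetric (centering r c)
  centering-symmetric i j = cong (_+ - (c * 1ℚ)) (I-symmetric r i j)

  centering-· : ∀ {s} (A : Matrix r s) → (∀ j → colSum A j ≡ 0ℚ) → centering r c · A ≈ A
  centering-· A colSum-A i j = begin
    (centering r c · A) i j                            ≡⟨ ·-distribʳ (I r) (neg (scale c (J r))) A i j ⟩
    (I r · A) i j + (neg (scale c (J r)) · A) i j      ≡⟨ cong₂ _+_ (·-identityˡ A i j)
                                                            (trans (·-negˡ (scale c (J r)) A i j) (cong -_ (·-scaleˡ c (J r) A i j))) ⟩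
    A i j + - (c * (J r · A) i j)                      ≡⟨ cong (λ s → A i j + - (c * s))
                                                            (trans (Σ-cong r (λ k → ℚP.*-identityˡ (A k j))) (colSum-A j)) ⟩
    A i j + - (c * 0ℚ)                                 ≡⟨ solve 2 (λ a c → a :+ :- (c :* con 0ℚ) := a) refl (A i j) c ⟩
    A i j                                              ∎
    where open ≡-Reasoning

  ·-centering : ∀ {s} (A : Matrix s r) → (∀ i → rowSum A i ≡ 0ℚ) → A · centering r c ≈ A
  ·-centering A rowSum-A i j = begin
    (A · centering r c) i j                            ≡⟨ ·-distribˡ A (I r) (neg (scale c (J r))) i j ⟩
    (A · I r) i j + (A · neg (scale c (J r))) i j      ≡⟨ cong₂ _+_ (·-identityʳ A i j)
                                                            (trans (·-negʳ A (scale c (J r)) i j) (cong -_ (·-scaleʳ c A (J r) i j))) ⟩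
    A i j + - (c * (A · J r) i j)                      ≡⟨ cong (λ s → A i j + - (c * s)) (trans (·-J A i j) (rowSum-A i)) ⟩
    A i j + - (c * 0ℚ)                                 ≡⟨ solve 2 (λ a c → a :+ :- (c :* con 0ℚ) := a) refl (A i j) c ⟩
    A i j                                              ∎
    where open ≡-Reasoning

↑-elim : ∀ {m n} (P : Fin (m ℕ.+ n) → Set) → (∀ q → P (q ↑ˡ n)) → (∀ q → P (m ↑ʳ q)) → ∀ i → P i
↑-elim {m} P left right i with splitAt m i in eq
... | inj₁ q = subst P (FP.splitAt⁻¹-↑ˡ eq) (left q)
... | inj₂ q = subst P (FP.splitAt⁻¹-↑ʳ eq) (right q)

outer : ∀ {r c} → (Fin r → ℚ) → (Fin c → ℚ) → Matrix r c
outer u a i j = u i * a j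

bordered : ∀ {m} → ℚ → (Fin m → ℚ) → (Fin m → ℚ) → Matrix m m → Matrix (suc m) (suc m)
bordered α row col B zero    zero    = α
bordered α row col B zero    (suc j) = row j
bordered α row col B (suc i) zero    = col i
bordered α row col B (suc i) (suc j) = B i j

blocks : ∀ {m} → Matrix m m → Matrix m m → Matrix m m → Matrix m m → Matrix (m ℕ.+ m) (m ℕ.+ m)
blocks {m} P Q R S i j =
  [ (λ i′ → [ P i′ , Q i′ ] (splitAt m j)) , (λ i′ → [ R i′ , S i′ ] (splitAt m j)) ] (splitAt m i)

module _ {m : ℕ} where

  module _ (a b : Fin m → ℚ) (C D : Matrix m m) where

    blockN-zero-↑ˡ : ∀ q → blockN a b C D zero (q ↑ˡ m) ≡ a q
    blockN-zero-↑ˡ q rewrite FP.splitAt-↑ˡ m q m = refl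

    blockN-zero-↑ʳ : ∀ q → blockN a b C D zero (m ↑ʳ q) ≡ b q
    blockN-zero-↑ʳ q rewrite FP.splitAt-↑ʳ m m q = refl

    blockN-suc-↑ˡ : ∀ i q → blockN a b C D (suc i) (q ↑ˡ m) ≡ C i q
    blockN-suc-↑ˡ i q rewrite FP.splitAt-↑ˡ m q m = refl

    blockN-suc-↑ʳ : ∀ i q → blockN a b C D (suc i) (m ↑ʳ q) ≡ D i q
    blockN-suc-↑ʳ i q rewrite FP.splitAt-↑ʳ m m q = refl

  module _ (u : Fin m → ℚ) (X : Matrix m m) (v : Fin m → ℚ) (Y : Matrix m m) where

    blockP-↑ˡ-zero : ∀ q → blockP u X v Y (q ↑ˡ m) zero ≡ u q
    blockP-↑ˡ-zero q rewrite FP.splitAt-↑ˡ m q m = refl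

    blockP-↑ˡ-suc : ∀ q j → blockP u X v Y (q ↑ˡ m) (suc j) ≡ X q j
    blockP-↑ˡ-suc q j rewrite FP.splitAt-↑ˡ m q m = refl

    blockP-↑ʳ-zero : ∀ q → blockP u X v Y (m ↑ʳ q) zero ≡ v q
    blockP-↑ʳ-zero q rewrite FP.splitAt-↑ʳ m m q = refl

    blockP-↑ʳ-suc : ∀ q j → blockP u X v Y (m ↑ʳ q) (suc j) ≡ Y q j
    blockP-↑ʳ-suc q j rewrite FP.splitAt-↑ʳ m m q = refl

  module _ (P Q R S : Matrix m m) where

    blocks-↑ˡ-↑ˡ : ∀ i j → blocks P Q R S (i ↑ˡ m) (j ↑ˡ m) ≡ P i j
    blocks-↑ˡ-↑ˡ i j rewrite FP.splitAt-↑ˡ m i m | FP.splitAt-↑ˡ m j m = refl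

    blocks-↑ˡ-↑ʳ : ∀ i j → blocks P Q R S (i ↑ˡ m) (m ↑ʳ j) ≡ Q i j
    blocks-↑ˡ-↑ʳ i j rewrite FP.splitAt-↑ˡ m i m | FP.splitAt-↑ʳ m m j = refl

    blocks-↑ʳ-↑ˡ : ∀ i j → blocks P Q R S (m ↑ʳ i) (j ↑ˡ m) ≡ R i j
    blocks-↑ʳ-↑ˡ i j rewrite FP.splitAt-↑ʳ m m i | FP.splitAt-↑ˡ m j m = refl

    blocks-↑ʳ-↑ʳ : ∀ i j → blocks P Q R S (m ↑ʳ i) (m ↑ʳ j) ≡ S i j
    blocks-↑ʳ-↑ʳ i j rewrite FP.splitAt-↑ʳ m m i | FP.splitAt-↑ʳ m m j = refl

    blocks-symmetric : Symmetric P → Q ᵀ ≈ R → Symmetric S → Symmetric (blocks P Q R S)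
    blocks-symmetric P-sym Qᵀ≈R S-sym = ↑-elim _ (λ i → ↑-elim _ (left-left i) (left-right i))
                                                 (λ i → ↑-elim _ (right-left i) (right-right i))
      where
      B = blocks P Q R S
      left-left : ∀ i j → B (j ↑ˡ m) (i ↑ˡ m) ≡ B (i ↑ˡ m) (j ↑ˡ m)
      left-left i j = trans (blocks-↑ˡ-↑ˡ j i) (trans (P-sym i j) (sym (blocks-↑ˡ-↑ˡ i j)))
      left-right : ∀ i j → B (m ↑ʳ j) (i ↑ˡ m) ≡ B (i ↑ˡ m) (m ↑ʳ j)
      left-right i j = trans (blocks-↑ʳ-↑ˡ j i) (trans (sym (Qᵀ≈R j i)) (sym (blocks-↑ˡ-↑ʳ i j)))
      right-left : ∀ i j → B (j ↑ˡ m) (m ↑ʳ i) ≡ B (m ↑ʳ i) (j ↑ˡ m)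
      right-left i j = trans (blocks-↑ˡ-↑ʳ j i) (trans (Qᵀ≈R i j) (sym (blocks-↑ʳ-↑ˡ i j)))
      right-right : ∀ i j → B (m ↑ʳ j) (m ↑ʳ i) ≡ B (m ↑ʳ i) (m ↑ʳ j)
      right-right i j = trans (blocks-↑ʳ-↑ʳ j i) (trans (S-sym i j) (sym (blocks-↑ʳ-↑ʳ i j)))

  module _ (a b : Fin m → ℚ) (C D : Matrix m m) (u : Fin m → ℚ) (X : Matrix m m) (v : Fin m → ℚ) (Y : Matrix m m) where

    private
      N = blockN a b C D
      P = blockP u X v Y

    blockN·blockP : N · P ≈ bordered (Σ m (λ q → a q * u q) + Σ m (λ q → b q * v q))
                                     (λ j → Σ m (λ q → a q * X q j) + Σ m (λ q → b q * Y q j))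
                                     (λ i → Σ m (λ q → C i q * u q) + Σ m (λ q → D i q * v q))
                                     (C · X ⊕ D · Y)
    blockN·blockP zero zero = trans (Σ-++ m m _) (cong₂ _+_
      (Σ-cong m (λ q → cong₂ _*_ (blockN-zero-↑ˡ a b C D q) (blockP-↑ˡ-zero u X v Y q)))
      (Σ-cong m (λ q → cong₂ _*_ (blockN-zero-↑ʳ a b C D q) (blockP-↑ʳ-zero u X v Y q))))
    blockN·blockP zero (suc j) = trans (Σ-++ m m _) (cong₂ _+_
      (Σ-cong m (λ q → cong₂ _*_ (blockN-zero-↑ˡ a b C D q) (blockP-↑ˡ-suc u X v Y q j)))
      (Σ-cong m (λ q → cong₂ _*_ (blockN-zero-↑ʳ a b C D q) (blockP-↑ʳ-suc u X v Y q j))))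
    blockN·blockP (suc i) zero = trans (Σ-++ m m _) (cong₂ _+_
      (Σ-cong m (λ q → cong₂ _*_ (blockN-suc-↑ˡ a b C D i q) (blockP-↑ˡ-zero u X v Y q)))
      (Σ-cong m (λ q → cong₂ _*_ (blockN-suc-↑ʳ a b C D i q) (blockP-↑ʳ-zero u X v Y q))))
    blockN·blockP (suc i) (suc j) = trans (Σ-++ m m _) (cong₂ _+_
      (Σ-cong m (λ q → cong₂ _*_ (blockN-suc-↑ˡ a b C D i q) (blockP-↑ˡ-suc u X v Y q j)))
      (Σ-cong m (λ q → cong₂ _*_ (blockN-suc-↑ʳ a b C D i q) (blockP-↑ʳ-suc u X v Y q j))))

    blockP·blockN : P · N ≈ blocks (outer u a ⊕ X · C) (outer u b ⊕ X · D) (outer v a ⊕ Y · C) (outer v b ⊕ Y · D)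
    blockP·blockN = ↑-elim _ (λ i → ↑-elim _ (left-left i) (left-right i))
                             (λ i → ↑-elim _ (right-left i) (right-right i))
      where
      B = blocks (outer u a ⊕ X · C) (outer u b ⊕ X · D) (outer v a ⊕ Y · C) (outer v b ⊕ Y · D)
      left-left : ∀ i j → (P · N) (i ↑ˡ m) (j ↑ˡ m) ≡ B (i ↑ˡ m) (j ↑ˡ m)
      left-left i j = trans (cong₂ _+_
        (cong₂ _*_ (blockP-↑ˡ-zero u X v Y i) (blockN-zero-↑ˡ a b C D j))
        (Σ-cong m (λ l → cong₂ _*_ (blockP-↑ˡ-suc u X v Y i l) (blockN-suc-↑ˡ a b C D l j))))
        (sym (blocks-↑ˡ-↑ˡ _ _ _ _ i j))
      left-right : ∀ i j → (P · N) (i ↑ˡ m) (m ↑ʳ j) ≡ B (i ↑ˡ m) (m ↑ʳ j)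
      left-right i j = trans (cong₂ _+_
        (cong₂ _*_ (blockP-↑ˡ-zero u X v Y i) (blockN-zero-↑ʳ a b C D j))
        (Σ-cong m (λ l → cong₂ _*_ (blockP-↑ˡ-suc u X v Y i l) (blockN-suc-↑ʳ a b C D l j))))
        (sym (blocks-↑ˡ-↑ʳ _ _ _ _ i j))
      right-left : ∀ i j → (P · N) (m ↑ʳ i) (j ↑ˡ m) ≡ B (m ↑ʳ i) (j ↑ˡ m)
      right-left i j = trans (cong₂ _+_
        (cong₂ _*_ (blockP-↑ʳ-zero u X v Y i) (blockN-zero-↑ˡ a b C D j))
        (Σ-cong m (λ l → cong₂ _*_ (blockP-↑ʳ-suc u X v Y i l) (blockN-suc-↑ˡ a b C D l j))))
        (sym (blocks-↑ʳ-↑ˡ _ _ _ _ i j))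
      right-right : ∀ i j → (P · N) (m ↑ʳ i) (m ↑ʳ j) ≡ B (m ↑ʳ i) (m ↑ʳ j)
      right-right i j = trans (cong₂ _+_
        (cong₂ _*_ (blockP-↑ʳ-zero u X v Y i) (blockN-zero-↑ʳ a b C D j))
        (Σ-cong m (λ l → cong₂ _*_ (blockP-↑ʳ-suc u X v Y i l) (blockN-suc-↑ʳ a b C D l j))))
        (sym (blocks-↑ʳ-↑ʳ _ _ _ _ i j))

-- N is the oriented incidence matrix of the cone over a graph whose oriented incidence matrix
-- is C (for the wheel, C is that of the rim); only the zero column sums of C are used.
module ConeIncidence {m : ℕ} (C : Matrix m m) (colSum-C : ∀ j → colSum C j ≡ 0ℚ)
                     (M : Matrix m m) (M-inverse : IsInverse (C · C ᵀ ⊕ I m) M) where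

  n : ℕ
  n = suc m

  t c : ℚ
  t = + n / 1
  c = + 1 / n

  A K X Y : Matrix m m
  A = C · C ᵀ ⊕ I m
  K = J m ⊕ neg (scale t (I m))
  X = M · K
  Y = neg (C ᵀ · X)

  ones zeros : Fin m → ℚ
  ones _ = 1ℚ
  zeros _ = 0ℚ

  N : Matrix n (m ℕ.+ m)
  N = blockN ones zeros (neg (I m)) C

  P₀ P : Matrix (m ℕ.+ m) n
  P₀ = blockP ones X zeros Y
  P = scale c P₀

  A-symmetric : Symmetric A
  A-symmetric = ·ᵀ⊕I-symmetric C

  A-rowSum : ∀ i → rowSum A i ≡ 1ℚ
  A-rowSum i = begin
    rowSum A i                          ≡⟨ Σ-distrib-+ m _ _ ⟩
    rowSum (C · C ᵀ) i + rowSum (I m) i ≡⟨ cong₂ _+_ (rowSum-· C (C ᵀ) colSum-C i) (rowSum-I m i) ⟩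
    rowSum C i * 0ℚ + 1ℚ                ≡⟨ solve 1 (λ x → x :* con 0ℚ :+ con 1ℚ := con 1ℚ) refl (rowSum C i) ⟩
    1ℚ                                  ∎
    where open ≡-Reasoning

  M-symmetric : Symmetric M
  M-symmetric = rightInverse-symmetric A-symmetric (proj₁ M-inverse)

  M-rowSum : ∀ i → rowSum M i ≡ 1ℚ
  M-rowSum i = begin
    rowSum M i          ≡⟨ sym (ℚP.*-identityʳ (rowSum M i)) ⟩
    rowSum M i * 1ℚ     ≡⟨ sym (rowSum-· M A A-rowSum i) ⟩
    rowSum (M · A) i    ≡⟨ Σ-cong m (proj₂ M-inverse i) ⟩
    rowSum (I m) i      ≡⟨ rowSum-I m i ⟩
    1ℚ                  ∎
    where open ≡-Reasoning

  M-colSum : ∀ j → colSum M j ≡ 1ℚ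
  M-colSum j = trans (Σ-cong m (λ i → M-symmetric j i)) (M-rowSum j)

  K-symmetric : Symmetric K
  K-symmetric i j = cong (λ d → 1ℚ + - (t * d)) (I-symmetric m i j)

  K-rowSum : ∀ i → rowSum K i ≡ - 1ℚ
  K-rowSum i = begin
    rowSum K i                                        ≡⟨ Σ-distrib-+ m _ _ ⟩
    Σ m (λ _ → 1ℚ) + Σ m (λ j → - (t * I m i j))      ≡⟨ cong₂ _+_ (Σ-one m) (trans (Σ-neg m _) (cong -_ (Σ-*ˡ m t (I m i)))) ⟩
    + m / 1 + - (t * rowSum (I m) i)                  ≡⟨ cong₂ (λ x y → + m / 1 + - (x * y)) (+suc/1 m) (rowSum-I m i) ⟩
    + m / 1 + - ((1ℚ + + m / 1) * 1ℚ)                 ≡⟨ solve 1 (λ x → x :+ :- ((con 1ℚ :+ x) :* con 1ℚ) := :- con 1ℚ) refl (+ m / 1) ⟩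
    - 1ℚ                                              ∎
    where open ≡-Reasoning

  K-colSum : ∀ j → colSum K j ≡ - 1ℚ
  K-colSum j = trans (Σ-cong m (λ i → K-symmetric j i)) (K-rowSum j)

  X-entry : ∀ i j → X i j ≡ 1ℚ + - (t * M i j)
  X-entry i j = begin
    X i j                                              ≡⟨ ·-distribˡ M (J m) (neg (scale t (I m))) i j ⟩
    (M · J m) i j + (M · neg (scale t (I m))) i j      ≡⟨ cong₂ _+_ (·-J M i j)
                                                            (trans (·-negʳ M (scale t (I m)) i j) (cong -_ (·-scaleʳ t M (I m) i j))) ⟩
    rowSum M i + - (t * (M · I m) i j)                 ≡⟨ cong₂ (λ x y → x + - (t * y)) (M-rowSum i) (·-identityʳ M i j) ⟩
    1ℚ + - (t * M i j)                                 ∎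
    where open ≡-Reasoning

  X-symmetric : Symmetric X
  X-symmetric i j = trans (X-entry j i) (trans (cong (λ x → 1ℚ + - (t * x)) (M-symmetric i j)) (sym (X-entry i j)))

  X-rowSum : ∀ i → rowSum X i ≡ - 1ℚ
  X-rowSum i = trans (rowSum-· M K K-rowSum i) (trans (cong (_* - 1ℚ) (M-rowSum i)) (ℚP.*-identityˡ (- 1ℚ)))

  X-colSum : ∀ j → colSum X j ≡ - 1ℚ
  X-colSum j = trans (colSum-· M K M-colSum j) (trans (cong (1ℚ *_) (K-colSum j)) (ℚP.*-identityˡ (- 1ℚ)))

  Y-rowSum : ∀ i → rowSum Y i ≡ 0ℚ
  Y-rowSum i = begin
    rowSum Y i                ≡⟨ Σ-neg m _ ⟩
    - rowSum (C ᵀ · X) i      ≡⟨ cong -_ (rowSum-· (C ᵀ) X X-rowSum i) ⟩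
    - (colSum C i * - 1ℚ)     ≡⟨ cong (λ x → - (x * - 1ℚ)) (colSum-C i) ⟩
    - (0ℚ * - 1ℚ)             ≡⟨ solve 0 (:- (con 0ℚ :* :- con 1ℚ) := con 0ℚ) refl ⟩
    0ℚ                        ∎
    where open ≡-Reasoning

  A·X≈K : A · X ≈ K
  A·X≈K i j = begin
    (A · (M · K)) i j  ≡⟨ sym (·-assoc A M K i j) ⟩
    ((A · M) · K) i j  ≡⟨ ·-congˡ K (proj₁ M-inverse) i j ⟩
    (I m · K) i j      ≡⟨ ·-identityˡ K i j ⟩
    K i j              ∎
    where open ≡-Reasoning

  -I·X⊕C·Y≈-K : neg (I m) · X ⊕ C · Y ≈ neg K
  -I·X⊕C·Y≈-K i j = begin
    (neg (I m) · X) i j + (C · Y) i j             ≡⟨ cong₂ _+_ (trans (·-negˡ (I m) X i j) (cong -_ (·-identityˡ X i j)))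
                                                               (trans (·-negʳ C (C ᵀ · X) i j) (cong -_ (sym (·-assoc C (C ᵀ) X i j)))) ⟩
    - X i j + - ((C · C ᵀ) · X) i j               ≡⟨ solve 2 (λ x y → :- x :+ :- y := :- (y :+ x)) refl (X i j) (((C · C ᵀ) · X) i j) ⟩
    - (((C · C ᵀ) · X) i j + X i j)               ≡⟨ cong (λ x → - (((C · C ᵀ) · X) i j + x)) (sym (·-identityˡ X i j)) ⟩
    - (((C · C ᵀ) · X) i j + (I m · X) i j)       ≡⟨ cong -_ (sym (·-distribʳ (C · C ᵀ) (I m) X i j)) ⟩
    - (A · X) i j                                 ≡⟨ cong -_ (A·X≈K i j) ⟩
    - K i j                                       ∎
    where open ≡-Reasoning

  N-colSum : ∀ j → colSum N j ≡ 0ℚ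
  N-colSum = ↑-elim _ left right
    where
    left : ∀ q → colSum N (q ↑ˡ m) ≡ 0ℚ
    left q = begin
      N zero (q ↑ˡ m) + Σ m (λ i → N (suc i) (q ↑ˡ m))  ≡⟨ cong₂ _+_ (blockN-zero-↑ˡ ones zeros (neg (I m)) C q)
                                                             (trans (Σ-cong m (λ i → blockN-suc-↑ˡ ones zeros (neg (I m)) C i q)) (Σ-neg m _)) ⟩
      1ℚ + - colSum (I m) q                             ≡⟨ cong (λ x → 1ℚ + - x) (trans (Σ-cong m (λ i → I-symmetric m q i)) (rowSum-I m q)) ⟩
      1ℚ + - 1ℚ                                         ≡⟨ ℚP.+-inverseʳ 1ℚ ⟩
      0ℚ                                                ∎
      where open ≡-Reasoning
    right : ∀ q → colSum N (m ↑ʳ q) ≡ 0ℚ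
    right q = trans (cong₂ _+_ (blockN-zero-↑ʳ ones zeros (neg (I m)) C q) (Σ-cong m (λ i → blockN-suc-↑ʳ ones zeros (neg (I m)) C i q)))
                    (trans (ℚP.+-identityˡ (colSum C q)) (colSum-C q))

  P₀-rowSum : ∀ i → rowSum P₀ i ≡ 0ℚ
  P₀-rowSum = ↑-elim _ left right
    where
    left : ∀ q → rowSum P₀ (q ↑ˡ m) ≡ 0ℚ
    left q = trans (cong₂ _+_ (blockP-↑ˡ-zero ones X zeros Y q) (trans (Σ-cong m (blockP-↑ˡ-suc ones X zeros Y q)) (X-rowSum q)))
                   (ℚP.+-inverseʳ 1ℚ)
    right : ∀ q → rowSum P₀ (m ↑ʳ q) ≡ 0ℚ
    right q = trans (cong₂ _+_ (blockP-↑ʳ-zero ones X zeros Y q) (trans (Σ-cong m (blockP-↑ʳ-suc ones X zeros Y q)) (Y-rowSum q)))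
                    (ℚP.+-identityˡ 0ℚ)

  P-rowSum : ∀ i → rowSum P i ≡ 0ℚ
  P-rowSum i = trans (Σ-*ˡ n c (P₀ i)) (trans (cong (c *_) (P₀-rowSum i)) (ℚP.*-zeroʳ c))

  -- Q = n I − J
  Q : Matrix n n
  Q = bordered (+ m / 1) (λ _ → - 1ℚ) (λ _ → - 1ℚ) (neg K)

  N·P₀≈Q : N · P₀ ≈ Q
  N·P₀≈Q i j = trans (blockN·blockP ones zeros (neg (I m)) C ones X zeros Y i j) (entry i j)
    where
    Σ-zero* : ∀ (f : Fin m → ℚ) → Σ m (λ q → 0ℚ * f q) ≡ 0ℚ
    Σ-zero* f = trans (Σ-cong m (λ q → ℚP.*-zeroˡ (f q))) (Σ-zero m)
    Σ-*zero : ∀ (f : Fin m → ℚ) → Σ m (λ q → f q * 0ℚ) ≡ 0ℚ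
    Σ-*zero f = trans (Σ-cong m (λ q → ℚP.*-zeroʳ (f q))) (Σ-zero m)
    entry : ∀ i j → bordered _ _ _ (neg (I m) · X ⊕ C · Y) i j ≡ Q i j
    entry zero zero = trans (cong₂ _+_ (trans (Σ-cong m (λ _ → ℚP.*-identityˡ 1ℚ)) (Σ-one m)) (Σ-zero* zeros))
                            (ℚP.+-identityʳ (+ m / 1))
    entry zero (suc j) = trans (cong₂ _+_ (trans (Σ-cong m (λ q → ℚP.*-identityˡ (X q j))) (X-colSum j)) (Σ-zero* (λ q → Y q j)))
                               (ℚP.+-identityʳ (- 1ℚ))
    entry (suc i) zero = trans (cong₂ _+_ (trans (Σ-cong m (λ q → ℚP.*-identityʳ (- I m i q)))
                                                (trans (Σ-neg m (I m i)) (cong -_ (rowSum-I m i))))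
                                         (Σ-*zero (C i)))
                               (ℚP.+-identityʳ (- 1ℚ))
    entry (suc i) (suc j) = -I·X⊕C·Y≈-K i j

  c*Q≈centering : scale c Q ≈ centering n c
  c*Q≈centering zero zero = begin
    c * (+ m / 1)                      ≡⟨ solve 2 (λ c x → c :* x := c :* (con 1ℚ :+ x) :+ :- (c :* con 1ℚ)) refl c (+ m / 1) ⟩
    c * (1ℚ + + m / 1) + - (c * 1ℚ)    ≡⟨ cong (λ x → c * x + - (c * 1ℚ)) (sym (+suc/1 m)) ⟩
    c * t + - (c * 1ℚ)                 ≡⟨ cong (λ x → x + - (c * 1ℚ)) (1/n*n≡1 m) ⟩
    1ℚ + - (c * 1ℚ)                    ∎
    where open ≡-Reasoning
  c*Q≈centering zero (suc j) = solve 1 (λ c → c :* :- con 1ℚ := con 0ℚ :+ :- (c :* con 1ℚ)) refl c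
  c*Q≈centering (suc i) zero = solve 1 (λ c → c :* :- con 1ℚ := con 0ℚ :+ :- (c :* con 1ℚ)) refl c
  c*Q≈centering (suc i) (suc j) = begin
    c * - (1ℚ + - (t * I m i j))         ≡⟨ solve 3 (λ c t d → c :* :- (con 1ℚ :+ :- (t :* d)) := (c :* t) :* d :+ :- (c :* con 1ℚ)) refl c t (I m i j) ⟩
    (c * t) * I m i j + - (c * 1ℚ)       ≡⟨ cong (λ x → x * I m i j + - (c * 1ℚ)) (1/n*n≡1 m) ⟩
    1ℚ * I m i j + - (c * 1ℚ)            ≡⟨ cong (λ x → x + - (c * 1ℚ)) (trans (ℚP.*-identityˡ (I m i j)) (sym (δ-suc (toℕ i) (toℕ j)))) ⟩
    I n (suc i) (suc j) + - (c * 1ℚ)     ∎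
    where open ≡-Reasoning

  N·P≈centering : N · P ≈ centering n c
  N·P≈centering i j = trans (·-scaleʳ c N P₀ i j) (trans (cong (c *_) (N·P₀≈Q i j)) (c*Q≈centering i j))

  Cᵀ·X·C-symmetric : Symmetric ((C ᵀ · X) · C)
  Cᵀ·X·C-symmetric i j = begin
    ((C ᵀ · X) · C) j i          ≡⟨ ᵀ-· (C ᵀ · X) C i j ⟩
    (C ᵀ · (C ᵀ · X) ᵀ) i j      ≡⟨ ·-congʳ (C ᵀ) (λ a b → trans (ᵀ-· (C ᵀ) X a b) (·-congˡ C X-symmetric a b)) i j ⟩
    (C ᵀ · (X · C)) i j          ≡⟨ sym (·-assoc (C ᵀ) X C i j) ⟩
    ((C ᵀ · X) · C) i j          ∎
    where open ≡-Reasoning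

  P₀·N-symmetric : Symmetric (P₀ · N)
  P₀·N-symmetric = symmetric-resp-≈ (blockP·blockN ones zeros (neg (I m)) C ones X zeros Y)
    (blocks-symmetric _ _ _ _ upper-left-symmetric upper-rightᵀ≈lower-left lower-right-symmetric)
    where
    ·-I≈neg : ∀ Z → Z · neg (I m) ≈ neg Z
    ·-I≈neg Z i j = trans (·-negʳ Z (I m) i j) (cong -_ (·-identityʳ Z i j))
    upper-left-symmetric : Symmetric (outer ones ones ⊕ X · neg (I m))
    upper-left-symmetric i j = cong (λ x → 1ℚ * 1ℚ + x)
      (trans (·-I≈neg X j i) (trans (cong -_ (X-symmetric i j)) (sym (·-I≈neg X i j))))
    upper-rightᵀ≈lower-left : (outer ones zeros ⊕ X · C) ᵀ ≈ outer zeros ones ⊕ Y · neg (I m)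
    upper-rightᵀ≈lower-left i j = cong₂ _+_ (trans (ℚP.*-zeroʳ 1ℚ) (sym (ℚP.*-zeroˡ 1ℚ))) (begin
      (X · C) j i          ≡⟨ ᵀ-· X C i j ⟩
      (C ᵀ · X ᵀ) i j      ≡⟨ ·-congʳ (C ᵀ) X-symmetric i j ⟩
      (C ᵀ · X) i j        ≡⟨ solve 1 (λ x → x := :- :- x) refl _ ⟩
      - Y i j              ≡⟨ sym (·-I≈neg Y i j) ⟩
      (Y · neg (I m)) i j  ∎)
      where open ≡-Reasoning
    Y·C≈-Cᵀ·X·C : Y · C ≈ neg ((C ᵀ · X) · C)
    Y·C≈-Cᵀ·X·C = ·-negˡ (C ᵀ · X) C
    lower-right-symmetric : Symmetric (outer zeros zeros ⊕ Y · C)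
    lower-right-symmetric i j = cong (λ x → 0ℚ * 0ℚ + x)
      (trans (Y·C≈-Cᵀ·X·C j i) (trans (cong -_ (Cᵀ·X·C-symmetric i j)) (sym (Y·C≈-Cᵀ·X·C i j))))

  moorePenrose : IsMoorePenroseInverse N P
  moorePenrose = N·P·N≈N , P·N·P≈P , N·P-symmetric , P·N-symmetric
    where
    N·P·N≈N : (N · P) · N ≈ N
    N·P·N≈N i j = trans (·-congˡ N N·P≈centering i j) (centering-· c N N-colSum i j)
    P·N·P≈P : (P · N) · P ≈ P
    P·N·P≈P i j = trans (·-assoc P N P i j) (trans (·-congʳ P N·P≈centering i j) (·-centering c P P-rowSum i j))
    N·P-symmetric : Symmetric (N · P)
    N·P-symmetric = symmetric-resp-≈ N·P≈centering (centering-symmetric c)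
    P·N-symmetric : Symmetric (P · N)
    P·N-symmetric = symmetric-resp-≈ (·-scaleˡ c P₀ N) (scale-symmetric c P₀·N-symmetric)

-- evenFib d = F (2d) and evenFib-gap d = F (2d + 1) − 1; the recursion uses additions only,
-- so that non-negativity is immediate.
evenFib-pair : ℕ → ℚ × ℚ
evenFib-pair zero    = 0ℚ , 0ℚ
evenFib-pair (suc d) = u + e + 1ℚ , e + (u + e + 1ℚ)
  where
  u = proj₁ (evenFib-pair d)
  e = proj₂ (evenFib-pair d)

evenFib evenFib-gap : ℕ → ℚ
evenFib     = proj₁ ∘ evenFib-pair
evenFib-gap = proj₂ ∘ evenFib-pair

evenFib-rec : ∀ d → evenFib (suc (suc d)) + evenFib d ≡ evenFib (suc d) + evenFib (suc d) + evenFib (suc d)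
evenFib-rec d = solve 2 (λ u e → ((((u :+ e) :+ con 1ℚ) :+ (e :+ ((u :+ e) :+ con 1ℚ))) :+ con 1ℚ) :+ u
   := ((u :+ e) :+ con 1ℚ) :+ ((u :+ e) :+ con 1ℚ) :+ ((u :+ e) :+ con 1ℚ)) refl (evenFib d) (evenFib-gap d)

evenFib-nonNegative : ∀ d → NonNegative (evenFib d) × NonNegative (evenFib-gap d)
evenFib-nonNegative zero    = nonNegative {0ℚ} ℚP.≤-refl , nonNegative {0ℚ} ℚP.≤-refl
evenFib-nonNegative (suc d) = u′≥0 , ℚP.nonNeg+nonNeg⇒nonNeg (evenFib-gap d) {{e≥0}} _ {{u′≥0}}
  where
  u≥0 = proj₁ (evenFib-nonNegative d)
  e≥0 = proj₂ (evenFib-nonNegative d)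
  u′≥0 : NonNegative (evenFib d + evenFib-gap d + 1ℚ)
  u′≥0 = ℚP.nonNeg+nonNeg⇒nonNeg (evenFib d + evenFib-gap d)
           {{ℚP.nonNeg+nonNeg⇒nonNeg (evenFib d) {{u≥0}} (evenFib-gap d) {{e≥0}}}}
           1ℚ {{nonNegative {1ℚ} (ℚP.<⇒≤ (ℚP.positive⁻¹ 1ℚ))}}

-- Vertices are naturals below m, so that C can act on functions ℕ → ℚ.
module Cycle (k : ℕ) where

  m : ℕ
  m = suc (suc k)

  next : ℕ → ℕ
  next x with suc x ℕ.≟ m
  ... | yes _ = 0
  ... | no _  = suc x

  prev : ℕ → ℕ
  prev zero    = suc k
  prev (suc x) = x

  next-last : ∀ {x} → suc x ≡ m → next x ≡ 0
  next-last {x} eq with suc x ℕ.≟ m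
  ... | yes _  = refl
  ... | no neq = ⊥-elim (neq eq)

  next-≢ : ∀ {x} → suc x ≢ m → next x ≡ suc x
  next-≢ {x} neq with suc x ℕ.≟ m
  ... | yes eq = ⊥-elim (neq eq)
  ... | no _   = refl

  next<m : ∀ {x} → x < m → next x < m
  next<m {x} x<m with suc x ℕ.≟ m
  ... | yes _  = ℕ.s≤s ℕ.z≤n
  ... | no neq = ℕP.≤∧≢⇒< x<m neq

  prev<m : ∀ {x} → x < m → prev x < m
  prev<m {zero}  _   = ℕP.n<1+n (suc k)
  prev<m {suc x} x<m = ℕP.<-trans (ℕP.n<1+n x) x<m

  next-prev : ∀ {x} → x < m → next (prev x) ≡ x
  next-prev {zero}  _   = next-last refl
  next-prev {suc x} x<m = next-≢ (ℕP.<⇒≢ x<m)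

  ≡next⇒≡prev : ∀ {a x} → a ≡ next x → x ≡ prev a
  ≡next⇒≡prev {a} {x} a≡next-x with suc x ℕ.≟ m
  ≡next⇒≡prev {zero}  _    | yes eq = ℕP.suc-injective eq
  ≡next⇒≡prev {suc a} ()   | yes _
  ≡next⇒≡prev         refl | no _   = refl

  δ-next : ∀ {a x} → a < m → δ a (next x) ≡ δ x (prev a)
  δ-next {a} {x} a<m = δ-cong-⇔ {a} {next x} ≡next⇒≡prev (λ x≡prev-a → sym (trans (cong next x≡prev-a) (next-prev a<m)))

  C : Matrix m m
  C = circ m (oneZerosMinusOne m)

  offset : ℕ → ℕ → ℕ
  offset a b = (b ℕ.+ (m ∸ a)) % m

  C-offset : ∀ i j → C i j ≡ δ (offset (toℕ i) (toℕ j)) 0 - δ (suc (offset (toℕ i) (toℕ j))) m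
  C-offset i j = trans (cong first-row (FP.toℕ-fromℕ< (m%n<n (toℕ j ℕ.+ (m ∸ toℕ i)) m)))
                       (first-row-δ (offset (toℕ i) (toℕ j)))
    where
    first-row : ℕ → ℚ
    first-row r = if ⌊ r ℕ.≟ 0 ⌋ then 1ℚ else (if ⌊ suc r ℕ.≟ m ⌋ then - 1ℚ else 0ℚ)
    first-row-δ : ∀ r → first-row r ≡ δ r 0 - δ (suc r) m
    first-row-δ zero    = refl
    first-row-δ (suc r) with ⌊ suc (suc r) ℕ.≟ m ⌋
    ... | true  = refl
    ... | false = refl

  offset-≤ : ∀ {a b} → a < m → b < m → a ≤ b → offset a b ≡ b ∸ a
  offset-≤ {a} {b} a<m b<m a≤b = begin
    (b ℕ.+ (m ∸ a)) % m   ≡⟨ cong (_% m) (trans (cong (ℕ._+ (m ∸ a)) (sym (ℕP.m∸n+n≡m a≤b)))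
                                  (trans (ℕP.+-assoc (b ∸ a) a (m ∸ a)) (cong ((b ∸ a) ℕ.+_) (ℕP.m+[n∸m]≡n (ℕP.<⇒≤ a<m))))) ⟩
    ((b ∸ a) ℕ.+ m) % m   ≡⟨ [m+n]%n≡m%n (b ∸ a) m ⟩
    (b ∸ a) % m           ≡⟨ m<n⇒m%n≡m (ℕP.≤-<-trans (ℕP.m∸n≤m b a) b<m) ⟩
    b ∸ a                 ∎
    where open ≡-Reasoning

  offset-> : ∀ {a b} → a < m → b < a → offset a b ≡ b ℕ.+ (m ∸ a)
  offset-> {a} {b} a<m b<a =
    m<n⇒m%n≡m (subst (b ℕ.+ (m ∸ a) <_) (ℕP.m+[n∸m]≡n (ℕP.<⇒≤ a<m)) (ℕP.+-monoˡ-< (m ∸ a) b<a))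

  δ-offset : ∀ {a b} → a < m → b < m → δ (offset a b) 0 ≡ δ a b
  δ-offset {a} {b} a<m b<m = δ-cong-⇔ {offset a b} {0} to from
    where
    to : offset a b ≡ 0 → a ≡ b
    to eq with ℕP.≤-<-connex a b
    ... | inj₁ a≤b = ℕP.≤-antisym a≤b (ℕP.m∸n≡0⇒m≤n (trans (sym (offset-≤ a<m b<m a≤b)) eq))
    ... | inj₂ b<a = ⊥-elim (ℕP.<⇒≱ a<m (ℕP.m∸n≡0⇒m≤n (ℕP.m+n≡0⇒n≡0 b (trans (sym (offset-> a<m b<a)) eq))))
    from : a ≡ b → offset a b ≡ 0
    from refl = trans (offset-≤ a<m b<m ℕP.≤-refl) (ℕP.n∸n≡0 a)

  suc-offset-next : ∀ {b} → b < m → suc (offset (next b) b) ≡ m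
  suc-offset-next {b} b<m with suc b ℕ.≟ m
  ... | yes sb≡m = trans (cong suc (offset-≤ (ℕ.s≤s ℕ.z≤n) b<m ℕ.z≤n)) sb≡m
  ... | no sb≢m  = trans (cong suc (offset-> (ℕP.≤∧≢⇒< b<m sb≢m) (ℕP.n<1+n b))) (ℕP.m+[n∸m]≡n b<m)

  δ-suc-offset : ∀ {a b} → a < m → b < m → δ (suc (offset a b)) m ≡ δ a (next b)
  δ-suc-offset {a} {b} a<m b<m = δ-cong-⇔ {suc (offset a b)} {m} to from
    where
    to : suc (offset a b) ≡ m → a ≡ next b
    to eq with ℕP.≤-<-connex a b
    ... | inj₁ a≤b = trans a≡0 (sym (next-last sb≡m))
      where
      suc[b∸a]≡m : suc (b ∸ a) ≡ m
      suc[b∸a]≡m = trans (cong suc (sym (offset-≤ a<m b<m a≤b))) eq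
      sb≡m : suc b ≡ m
      sb≡m = ℕP.≤-antisym b<m (subst (_≤ suc b) suc[b∸a]≡m (ℕ.s≤s (ℕP.m∸n≤m b a)))
      a≡0 : a ≡ 0
      a≡0 = ℕP.+-cancelˡ-≡ b a 0 (begin
        b ℕ.+ a           ≡⟨ cong (ℕ._+ a) (sym (ℕP.suc-injective (trans suc[b∸a]≡m (sym sb≡m)))) ⟩
        (b ∸ a) ℕ.+ a     ≡⟨ ℕP.m∸n+n≡m a≤b ⟩
        b                 ≡⟨ sym (ℕP.+-identityʳ b) ⟩
        b ℕ.+ 0           ∎)
        where open ≡-Reasoning
    ... | inj₂ b<a = sym (trans (next-≢ (λ sb≡m → ℕP.<⇒≢ a<m (trans (sym sb≡a) sb≡m))) sb≡a)
      where
      sb≡a : suc b ≡ a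
      sb≡a = ℕP.+-cancelʳ-≡ (m ∸ a) (suc b) a
               (trans (trans (cong suc (sym (offset-> a<m b<a))) eq) (sym (ℕP.m+[n∸m]≡n (ℕP.<⇒≤ a<m))))
    from : a ≡ next b → suc (offset a b) ≡ m
    from a≡next-b = subst (λ x → suc (offset x b) ≡ m) (sym a≡next-b) (suc-offset-next b<m)

  C-entry : ∀ i j → C i j ≡ δ (toℕ i) (toℕ j) - δ (toℕ i) (next (toℕ j))
  C-entry i j = trans (C-offset i j) (cong₂ _-_ (δ-offset (FP.toℕ<n i) (FP.toℕ<n j)) (δ-suc-offset (FP.toℕ<n i) (FP.toℕ<n j)))

  Σ-δ-difference : ∀ (F : ℕ → ℚ) {x y} → x < m → y < m →
                   Σ m (λ l → (δ (toℕ l) x - δ (toℕ l) y) * F (toℕ l)) ≡ F x - F y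
  Σ-δ-difference F {x} {y} x<m y<m = begin
    Σ m (λ l → (δ (toℕ l) x - δ (toℕ l) y) * F (toℕ l))                    ≡⟨ Σ-cong m (λ l → *-distribʳ-- (δ (toℕ l) x) (δ (toℕ l) y) (F (toℕ l))) ⟩
    Σ m (λ l → δ (toℕ l) x * F (toℕ l) - δ (toℕ l) y * F (toℕ l))          ≡⟨ Σ-distrib-- m (λ l → δ (toℕ l) x * F (toℕ l)) (λ l → δ (toℕ l) y * F (toℕ l)) ⟩
    Σ m (λ l → δ (toℕ l) x * F (toℕ l)) - Σ m (λ l → δ (toℕ l) y * F (toℕ l)) ≡⟨ cong₂ _-_ (Σ-δℕ m F x<m) (Σ-δℕ m F y<m) ⟩
    F x - F y                                                               ∎
    where
    open ≡-Reasoning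
    *-distribʳ-- : ∀ a b z → (a - b) * z ≡ a * z - b * z
    *-distribʳ-- = solve 3 (λ a b z → (a :- b) :* z := a :* z :- b :* z) refl

  C-col : ∀ j (F : ℕ → ℚ) → Σ m (λ l → C l j * F (toℕ l)) ≡ F (toℕ j) - F (next (toℕ j))
  C-col j F = trans (Σ-cong m (λ l → cong (_* F (toℕ l)) (C-entry l j)))
                    (Σ-δ-difference F (FP.toℕ<n j) (next<m (FP.toℕ<n j)))

  C-row : ∀ i (F : ℕ → ℚ) → Σ m (λ l → C i l * F (toℕ l)) ≡ F (toℕ i) - F (prev (toℕ i))
  C-row i F = trans (Σ-cong m (λ l → cong (_* F (toℕ l)) (trans (C-entry i l) (as-column l))))
                    (Σ-δ-difference F (FP.toℕ<n i) (prev<m (FP.toℕ<n i)))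
    where
    as-column : ∀ l → δ (toℕ i) (toℕ l) - δ (toℕ i) (next (toℕ l)) ≡ δ (toℕ l) (toℕ i) - δ (toℕ l) (prev (toℕ i))
    as-column l = cong₂ _-_ (δ-sym (toℕ i) (toℕ l)) (δ-next (FP.toℕ<n i))

  colSum-C : ∀ j → colSum C j ≡ 0ℚ
  colSum-C j = trans (Σ-cong m (λ l → sym (ℚP.*-identityʳ (C l j)))) (trans (C-col j (λ _ → 1ℚ)) (ℚP.+-inverseʳ 1ℚ))

  h : ℕ → ℚ
  h d = evenFib d + evenFib (m ∸ d)

  h-rec : ∀ d → suc d < m → h (suc (suc d)) + h d ≡ h (suc d) + h (suc d) + h (suc d)
  h-rec d sd<m = begin
    (u (suc (suc d)) + u j) + (u d + u (m ∸ d))           ≡⟨ cong (λ x → (u (suc (suc d)) + u j) + (u d + u x)) m∸d≡2+j ⟩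
    (u (suc (suc d)) + u j) + (u d + u (suc (suc j)))     ≡⟨ shuffle (u (suc (suc d))) (u j) (u d) (u (suc (suc j))) ⟩
    (u (suc (suc d)) + u d) + (u (suc (suc j)) + u j)     ≡⟨ cong₂ _+_ (evenFib-rec d) (evenFib-rec j) ⟩
    (x + x + x) + (y + y + y)                             ≡⟨ regroup x y ⟩
    (x + y) + (x + y) + (x + y)                           ≡⟨ cong (λ z → z + z + z) (cong (λ e → x + u e) (sym m∸1+d≡1+j)) ⟩
    h (suc d) + h (suc d) + h (suc d)                     ∎
    where
    open ≡-Reasoning
    u = evenFib
    j = m ∸ suc (suc d)
    x = u (suc d)
    y = u (suc j)
    m∸1+d≡1+j : m ∸ suc d ≡ suc j
    m∸1+d≡1+j = ℕP.+-∸-assoc 1 sd<m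
    m∸d≡2+j : m ∸ d ≡ suc (suc j)
    m∸d≡2+j = trans (ℕP.+-∸-assoc 1 (ℕP.<-trans (ℕP.n<1+n d) sd<m)) (cong suc m∸1+d≡1+j)
    shuffle : ∀ a b c d → (a + b) + (c + d) ≡ (a + c) + (d + b)
    shuffle = solve 4 (λ a b c d → (a :+ b) :+ (c :+ d) := (a :+ c) :+ (d :+ b)) refl
    regroup : ∀ x y → (x + x + x) + (y + y + y) ≡ (x + y) + (x + y) + (x + y)
    regroup = solve 2 (λ x y → (x :+ x :+ x) :+ (y :+ y :+ y) := (x :+ y) :+ (x :+ y) :+ (x :+ y)) refl

  h-reflect : ∀ {d} → d ≤ m → h (m ∸ d) ≡ h d
  h-reflect {d} d≤m = trans (cong (λ x → evenFib (m ∸ d) + evenFib x) (ℕP.m∸[m∸n]≡n d≤m)) (ℚP.+-comm (evenFib (m ∸ d)) (evenFib d))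

  D : ℚ
  D = (h 0 + h 0 + h 0) - (h 1 + h 1)

  D-positive : Positive D
  D-positive = subst Positive (sym D≡) (ℚP.nonNeg+pos⇒pos (u + e + e + e) {{u+3e≥0}} 1ℚ {{positive {1ℚ} (ℚP.positive⁻¹ 1ℚ)}})
    where
    u = evenFib (suc k)
    e = evenFib-gap (suc k)
    D≡ : D ≡ (u + e + e + e) + 1ℚ
    D≡ = solve 2 (λ u e → ((con 0ℚ :+ ((u :+ e) :+ con 1ℚ)) :+ (con 0ℚ :+ ((u :+ e) :+ con 1ℚ)) :+ (con 0ℚ :+ ((u :+ e) :+ con 1ℚ)))
           :- ((((con 0ℚ :+ con 0ℚ) :+ con 1ℚ) :+ u) :+ (((con 0ℚ :+ con 0ℚ) :+ con 1ℚ) :+ u))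
           := (u :+ e :+ e :+ e) :+ con 1ℚ) refl u e
    u≥0 = proj₁ (evenFib-nonNegative (suc k))
    e≥0 = proj₂ (evenFib-nonNegative (suc k))
    u+3e≥0 : NonNegative (u + e + e + e)
    u+3e≥0 = ℚP.nonNeg+nonNeg⇒nonNeg (u + e + e) {{ℚP.nonNeg+nonNeg⇒nonNeg (u + e)
               {{ℚP.nonNeg+nonNeg⇒nonNeg u {{u≥0}} e {{e≥0}}}} e {{e≥0}}}} e {{e≥0}}

  -- Abstract so that the type checker never tries to normalise 1/D.
  abstract
    w : ℚ
    w = (1/ D) {{ℚP.pos⇒nonZero D {{D-positive}}}}

    D*w≡1 : D * w ≡ 1ℚ
    D*w≡1 = ℚP.*-inverseʳ D {{ℚP.pos⇒nonZero D {{D-positive}}}}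

  g : ℕ → ℚ
  g d = h d * w

  G : ℕ → ℕ → ℚ
  G a b = g ∣ a - b ∣

  g-reflect : ∀ {d} → d ≤ m → g (m ∸ d) ≡ g d
  g-reflect d≤m = cong (_* w) (h-reflect d≤m)

  g-rec : ∀ d → suc d < m → g d + g (suc (suc d)) ≡ g (suc d) + g (suc d) + g (suc d)
  g-rec d sd<m = begin
    h d * w + h (suc (suc d)) * w                 ≡⟨ ℚP.+-comm (h d * w) _ ⟩
    h (suc (suc d)) * w + h d * w                 ≡⟨ sym (ℚP.*-distribʳ-+ w (h (suc (suc d))) (h d)) ⟩
    (h (suc (suc d)) + h d) * w                   ≡⟨ cong (_* w) (h-rec d sd<m) ⟩
    (h (suc d) + h (suc d) + h (suc d)) * w       ≡⟨ solve 2 (λ x w → (x :+ x :+ x) :* w := x :* w :+ x :* w :+ x :* w) refl (h (suc d)) w ⟩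
    h (suc d) * w + h (suc d) * w + h (suc d) * w ∎
    where open ≡-Reasoning

  g-diagonal : (g 0 + g 0 + g 0) - (g 1 + g 1) ≡ 1ℚ
  g-diagonal = trans (solve 3 (λ x y w → (x :* w :+ x :* w :+ x :* w) :- (y :* w :+ y :* w) := ((x :+ x :+ x) :- (y :+ y)) :* w)
                              refl (h 0) (h 1) w)
                     D*w≡1

  G-prev-< : ∀ {a b} → a < b → b < m → G (prev a) b ≡ g (suc (b ∸ a))
  G-prev-< {zero}  {b}   _   b<m = trans (cong g (ℕP.m≤n⇒∣n-m∣≡n∸m (ℕP.≤-pred b<m))) (g-reflect {suc b} b<m)
  G-prev-< {suc a} {b} a<b _   = cong g (trans (ℕP.m≤n⇒∣m-n∣≡n∸m (ℕP.<⇒≤ a<b′)) (ℕP.+-∸-assoc 1 a<b′))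
    where
    a<b′ : a < b
    a<b′ = ℕP.<-trans (ℕP.n<1+n a) a<b

  G-next-> : ∀ {a b} → b < a → a < m → G (next a) b ≡ g (suc (a ∸ b))
  G-next-> {a} {b} b<a a<m with suc a ℕ.≟ m
  ... | yes sa≡m = trans (sym (g-reflect (ℕP.<⇒≤ (ℕP.<-trans b<a a<m))))
                         (cong g (trans (cong (_∸ b) (sym sa≡m)) (ℕP.+-∸-assoc 1 (ℕP.<⇒≤ b<a))))
  ... | no _     = cong g (trans (ℕP.m≤n⇒∣n-m∣≡n∸m (ℕP.<⇒≤ (ℕP.m<n⇒m<1+n b<a))) (ℕP.+-∸-assoc 1 (ℕP.<⇒≤ b<a)))

  G-neighbours-< : ∀ {a b} → a < b → b < m → G (next a) b + G (prev a) b ≡ G a b + G a b + G a b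
  G-neighbours-< {a} {b} a<b b<m = begin
    G (next a) b + G (prev a) b       ≡⟨ cong₂ _+_ G-next (trans (G-prev-< a<b b<m) (cong (g ∘ suc) b∸a≡1+q)) ⟩
    g q + g (suc (suc q))             ≡⟨ g-rec q 1+q<m ⟩
    g (suc q) + g (suc q) + g (suc q) ≡⟨ cong (λ x → x + x + x) (sym G-here) ⟩
    G a b + G a b + G a b             ∎
    where
    open ≡-Reasoning
    q = b ∸ suc a
    b∸a≡1+q : b ∸ a ≡ suc q
    b∸a≡1+q = ℕP.+-∸-assoc 1 a<b
    1+q<m : suc q < m
    1+q<m = subst (_< m) b∸a≡1+q (ℕP.≤-<-trans (ℕP.m∸n≤m b a) b<m)
    G-here : G a b ≡ g (suc q)
    G-here = cong g (trans (ℕP.m≤n⇒∣m-n∣≡n∸m (ℕP.<⇒≤ a<b)) b∸a≡1+q)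
    G-next : G (next a) b ≡ g q
    G-next = trans (cong (λ x → G x b) (next-≢ (ℕP.<⇒≢ (ℕP.≤-<-trans a<b b<m)))) (cong g (ℕP.m≤n⇒∣m-n∣≡n∸m a<b))

  G-neighbours-> : ∀ {a b} → b < a → a < m → G (next a) b + G (prev a) b ≡ G a b + G a b + G a b
  G-neighbours-> {suc a} {b} b<1+a 1+a<m = begin
    G (next (suc a)) b + G a b              ≡⟨ cong₂ _+_ (trans (G-next-> b<1+a 1+a<m) (cong (g ∘ suc) 1+a∸b≡1+q)) G-prev ⟩
    g (suc (suc q)) + g q                   ≡⟨ ℚP.+-comm (g (suc (suc q))) (g q) ⟩
    g q + g (suc (suc q))                   ≡⟨ g-rec q 1+q<m ⟩
    g (suc q) + g (suc q) + g (suc q)       ≡⟨ cong (λ x → x + x + x) (sym G-here) ⟩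
    G (suc a) b + G (suc a) b + G (suc a) b ∎
    where
    open ≡-Reasoning
    b≤a : b ≤ a
    b≤a = ℕP.≤-pred b<1+a
    q = a ∸ b
    1+a∸b≡1+q : suc a ∸ b ≡ suc q
    1+a∸b≡1+q = ℕP.+-∸-assoc 1 b≤a
    1+q<m : suc q < m
    1+q<m = subst (_< m) 1+a∸b≡1+q (ℕP.≤-<-trans (ℕP.m∸n≤m (suc a) b) 1+a<m)
    G-here : G (suc a) b ≡ g (suc q)
    G-here = cong g (trans (ℕP.m≤n⇒∣n-m∣≡n∸m (ℕP.<⇒≤ b<1+a)) 1+a∸b≡1+q)
    G-prev : G a b ≡ g q
    G-prev = cong g (ℕP.m≤n⇒∣n-m∣≡n∸m b≤a)

  G-next-diagonal : ∀ {a} → a < m → G (next a) a ≡ g 1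
  G-next-diagonal {a} a<m with suc a ℕ.≟ m
  ... | yes sa≡m = trans (cong g (ℕP.suc-injective sa≡m)) (g-reflect {1} (ℕ.s≤s ℕ.z≤n))
  ... | no _     = cong g (trans (ℕP.m≤n⇒∣n-m∣≡n∸m (ℕP.n≤1+n a)) (ℕP.m+n∸n≡m 1 a))

  G-prev-diagonal : ∀ a → G (prev a) a ≡ g 1
  G-prev-diagonal zero    = g-reflect {1} (ℕ.s≤s ℕ.z≤n)
  G-prev-diagonal (suc a) = cong g (trans (ℕP.m≤n⇒∣m-n∣≡n∸m (ℕP.n≤1+n a)) (ℕP.m+n∸n≡m 1 a))

  G-equation-≢ : ∀ {a b} → a ≢ b → G (next a) b + G (prev a) b ≡ G a b + G a b + G a b →
                 (G a b + G a b + G a b) - (G (next a) b + G (prev a) b) ≡ δ a b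
  G-equation-≢ {a} {b} a≢b neighbours = trans (cong (λ x → (G a b + G a b + G a b) - x) neighbours)
                                              (trans (ℚP.+-inverseʳ (G a b + G a b + G a b)) (sym (δ-≢ a≢b)))

  G-equation : ∀ {a b} → a < m → b < m → (G a b + G a b + G a b) - (G (next a) b + G (prev a) b) ≡ δ a b
  G-equation {a} {b} a<m b<m with ℕP.<-cmp a b
  ... | tri< a<b a≢b _ = G-equation-≢ a≢b (G-neighbours-< a<b b<m)
  ... | tri> _ a≢b b<a = G-equation-≢ a≢b (G-neighbours-> b<a a<m)
  ... | tri≈ _ refl _  = begin
    (G a a + G a a + G a a) - (G (next a) a + G (prev a) a) ≡⟨ cong₂ (λ x y → (x + x + x) - y) (cong g (ℕP.∣n-n∣≡0 a))
                                                                   (cong₂ _+_ (G-next-diagonal a<m) (G-prev-diagonal a)) ⟩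
    (g 0 + g 0 + g 0) - (g 1 + g 1)                         ≡⟨ g-diagonal ⟩
    1ℚ                                                      ≡⟨ sym (δ-≡ refl) ⟩
    δ a a                                                   ∎
    where open ≡-Reasoning

  M : Matrix m m
  M i j = G (toℕ i) (toℕ j)

  A·M≈I : (C · C ᵀ ⊕ I m) · M ≈ I m
  A·M≈I i j = begin
    ((C · C ᵀ ⊕ I m) · M) i j                   ≡⟨ ·-distribʳ (C · C ᵀ) (I m) M i j ⟩
    ((C · C ᵀ) · M) i j + (I m · M) i j         ≡⟨ cong₂ _+_ (·-assoc C (C ᵀ) M i j) (·-identityˡ M i j) ⟩
    (C · (C ᵀ · M)) i j + G a b                 ≡⟨ cong (λ x → x + G a b) (trans (Σ-cong m (λ l → cong (C i l *_) (C-col l (λ x → G x b)))) (C-row i W)) ⟩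
    W a - W (prev a) + G a b                    ≡⟨ cong (λ x → W a - (G (prev a) b - G x b) + G a b) (next-prev (FP.toℕ<n i)) ⟩
    (G a b - G (next a) b) - (G (prev a) b - G a b) + G a b
                                                ≡⟨ solve 3 (λ x y z → (x :- y) :- (z :- x) :+ x := (x :+ x :+ x) :- (y :+ z)) refl (G a b) (G (next a) b) (G (prev a) b) ⟩
    (G a b + G a b + G a b) - (G (next a) b + G (prev a) b)
                                                ≡⟨ G-equation (FP.toℕ<n i) (FP.toℕ<n j) ⟩
    δ a b                                       ∎
    where
    open ≡-Reasoning
    a = toℕ i
    b = toℕ j
    W : ℕ → ℚ
    W x = G x b - G (next x) b

mainTheorem6 : (m : ℕ) → 3 ≤ m →
    let n = suc m
        C = circ m (oneZerosMinusOne m)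
        N = blockN (λ _ → 1ℚ) (λ _ → 0ℚ) (neg (I m)) C
    in Σ[ M ∈ Matrix m m ] (IsInverse (C · C ᵀ ⊕ I m) M ×
         IsMoorePenroseInverse N
           (scale (+ 1 / n)
             (blockP (λ _ → 1ℚ) (M · (J m ⊕ neg (scale (+ n / 1) (I m))))
                     (λ _ → 0ℚ) (neg (C ᵀ · (M · (J m ⊕ neg (scale (+ n / 1) (I m)))))))))
-- The argument works for every m ≥ 2; the hypothesis 3 ≤ m only rules out m ≤ 1.
mainTheorem6 (suc (suc (suc k))) (ℕ.s≤s (ℕ.s≤s (ℕ.s≤s ℕ.z≤n))) = M , M-inverse , moorePenrose
  where
  open Cycle (suc k) using (C; colSum-C; M; A·M≈I)
  M-inverse : IsInverse (C · C ᵀ ⊕ I _) M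
  M-inverse = inverse-of-symmetric {M = M} (·ᵀ⊕I-symmetric C) A·M≈I
  open ConeIncidence C colSum-C M M-inverse using (moorePenrose)
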